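{- Let $G$ be a finite simple $2$-connected outerplanar graph, drawn in the plane with all vertices on the outer face, such that every inner face of this drawing contains exactly $5$ vertices. Then $G$ has a complete conflict-free coloring with $3$ colors, i.e. a map $C:V(G)\to\{1,2,3\}$ such that for every $v\in V(G)$ there exists $i$ with $|N(v)\cap C^{ -1}(i)|=1$.
   Context: $N(v)$ denotes the open neighborhood of $v$. Inner faces are the bounded faces of the outerplanar drawing. -}

module Defs where

open import Data.Nat using (ℕ; zero; suc; _<_; _≤_)
open import Data.Fin using (Fin; toℕ; _≟_)
open import Data.Fin.Properties using ()
open import Data.Bool using (Bool; true; false; _∧_; if_then_else_)
open import Data.List using (List; map; allFin)
open import Data.Nat.ListAction using (sum)
open import Data.Product using (Σ; ∃; _×_; _,_)
open import Data.Sum using (_⊎_)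
open import Data.Unit using (⊤)
open import Relation.Nullary using (¬_)
open import Relation.Nullary.Decidable using (⌊_⌋)
open import Relation.Binary.PropositionalEquality using (_≡_; _≢_)
open import Function.Definitions using (Injective)

record Graph (n : ℕ) : Set where
  field
    adj   : Fin n → Fin n → Bool
    sym   : ∀ u v → adj u v ≡ adj v u
    irrefl : ∀ v → adj v v ≡ false
open Graph public

data Reach {n : ℕ} (G : Graph n) (ok : Fin n → Set) : Fin n → Fin n → Set where
  here : ∀ {u} → ok u → Reach G ok u u
  step : ∀ {u v w} → ok u → adj G u v ≡ true → Reach G ok v w → Reach G ok u w

Connected : ∀ {n} → Graph n → Set
Connected {n} G = ∀ (u w : Fin n) → Reach G (λ _ → ⊤) u w

TwoConnected : ∀ {n} → Graph n → Set
TwoConnected {n} G =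
  (3 ≤ n) × Connected G ×
  (∀ (x u w : Fin n) → u ≢ x → w ≢ x → Reach G (λ z → z ≢ x) u w)

-- An outerplanar drawing with all vertices on the outer face, up to
-- topological equivalence: the cyclic order `pos` of the vertices around the
-- outer face (vertices in convex position), such that no two edges cross.
Crossing : ∀ {n} → (Fin n → Fin n) → Fin n → Fin n → Fin n → Fin n → Set
Crossing pos a b c d =
  (toℕ (pos a) < toℕ (pos c)) × (toℕ (pos c) < toℕ (pos b)) × (toℕ (pos b) < toℕ (pos d))

record OuterplanarDrawing {n : ℕ} (G : Graph n) : Set where
  field
    pos       : Fin n → Fin n
    pos-inj   : Injective _≡_ _≡_ pos
    noCross   : ∀ a b c d → adj G a b ≡ true → adj G c d ≡ true → ¬ Crossing pos a b c d
open OuterplanarDrawing public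

CycNbr : (k : ℕ) → Fin k → Fin k → Set
CycNbr k i j =
  (toℕ j ≡ suc (toℕ i)) ⊎ (toℕ i ≡ suc (toℕ j)) ⊎
  ((toℕ i ≡ 0) × (suc (toℕ j) ≡ k)) ⊎ ((toℕ j ≡ 0) × (suc (toℕ i) ≡ k))

-- An inner (bounded) face of the drawing with k vertices: vertices f 0, …, f (k-1)
-- in increasing position along the outer face, with k ≥ 3, such that two of them
-- are adjacent in G exactly when they are cyclically consecutive (the boundary
-- polygon consists of edges, and no edge runs through its interior).
IsInnerFace : ∀ {n} {G : Graph n} → OuterplanarDrawing G → (k : ℕ) → (Fin k → Fin n) → Set
IsInnerFace {n} {G} D k f =
  (3 ≤ k) ×
  (∀ (i j : Fin k) → toℕ i < toℕ j → toℕ (pos D (f i)) < toℕ (pos D (f j))) ×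
  (∀ (i j : Fin k) → (adj G (f i) (f j) ≡ true → CycNbr k i j) × (CycNbr k i j → adj G (f i) (f j) ≡ true))

nbrsWithColour : ∀ {n c} → Graph n → (Fin n → Fin c) → Fin n → Fin c → ℕ
nbrsWithColour {n} G C v i =
  sum (map (λ u → if adj G v u ∧ ⌊ C u ≟ i ⌋ then 1 else 0) (allFin n))

IsCompleteCFColouring : ∀ {n c} → Graph n → (Fin n → Fin c) → Set
IsCompleteCFColouring {n} {c} G C = ∀ (v : Fin n) → ∃ λ (i : Fin c) → nbrsWithColour G C v i ≡ 1

module Submission where

-- Number the vertices 0, …, n-1 in their order along the outer
-- face (module ByPosition); edges then never cross: there are no edges ab, cd
-- with a < c < b < d.  In this setting (module OnPositions):
--  * below every edge xy with x + 1 < y lies an inner face: the walk from x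
--    that always moves to the farthest neighbour not beyond y traces it
--    (FaceBelow); 2-connectivity guarantees progress, planarity that the walk
--    visits no chords.  As all inner faces have 5 vertices, this face is a
--    pentagon x < q₁ < q₂ < q₃ < y (pentagon-below);
--  * by recursion on y - x, the vertices strictly between x and y are coloured
--    so that each of them sees some colour exactly once, while the interior
--    neighbours of x and y avoid prescribed colours fx, fy (GoodBelow,
--    fillBelow-good): q₁, q₂, q₃ get fresh colours so that they see x, q₁, y
--    with a unique colour, and the four sides of the pentagon are recursed on;
--  * 0 and n-1 are adjacent (outer-edge); colouring them 0F and 1F and filling
--    in below this edge colours the whole graph (colouring-unique).

open import Defs using (Graph; adj; irrefl; Reach; here; step; TwoConnected;
  OuterplanarDrawing; pos; pos-inj; noCross; CycNbr; IsInnerFace; nbrsWithColour; IsCompleteCFColouring)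
open import Data.Nat
open import Data.Nat.Properties
open import Data.Bool using (Bool; true; false; if_then_else_; _∧_)
open import Data.Fin as Fin using (Fin; toℕ; fromℕ<; punchOut)
open import Data.Fin.Patterns using (0F; 1F; 2F)
open import Data.Fin.Properties as Finₚ using (toℕ<n; toℕ-injective; toℕ-fromℕ<;
  punchOut-injective; injective⇒≤; any?)
open import Data.List using (map; allFin; tabulate)
open import Data.List.Properties using (map-tabulate)
open import Data.Nat.ListAction using (sum)
open import Data.Product using (∃; _×_; _,_; proj₁; proj₂; map₂)
open import Data.Sum using (_⊎_; inj₁; inj₂)
open import Data.Empty using (⊥; ⊥-elim)
open import Relation.Nullary using (¬_; yes; no)
open import Relation.Nullary.Decidable using (⌊_⌋)
open import Relation.Binary using (tri<; tri≈; tri>)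
open import Relation.Binary.PropositionalEquality
open import Function using (_∘_; id; case_of_)
open import Function.Definitions using (Injective)

injective⇒surjective : ∀ {m} (f : Fin m → Fin m) → Injective _≡_ _≡_ f → ∀ t → ∃ λ j → f j ≡ t
injective⇒surjective {zero} f inj ()
injective⇒surjective {suc m} f inj t with any? (λ j → f j Fin.≟ t)
... | yes hit = hit
... | no miss = ⊥-elim (<-irrefl refl (injective⇒≤ {f = squeeze} squeeze-injective))
  where
  avoids : ∀ j → t ≢ f j
  avoids j eq = miss (j , sym eq)
  squeeze : Fin (suc m) → Fin m
  squeeze j = punchOut (avoids j)
  squeeze-injective : Injective _≡_ _≡_ squeeze
  squeeze-injective eq = inj (punchOut-injective (avoids _) (avoids _) eq)

indicator : Bool → ℕ
indicator b = if b then 1 else 0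

count-none : ∀ {m} (b : Fin m → Bool) → (∀ u → b u ≡ false) → sum (tabulate (indicator ∘ b)) ≡ 0
count-none {zero} b none = refl
count-none {suc m} b none rewrite none Fin.zero = count-none (b ∘ Fin.suc) (none ∘ Fin.suc)

count-unique : ∀ {m} (b : Fin m → Bool) (u₀ : Fin m) → b u₀ ≡ true → (∀ u → b u ≡ true → u ≡ u₀) →
               sum (map (indicator ∘ b) (allFin m)) ≡ 1
count-unique {m} b u₀ hit unique rewrite map-tabulate {n = m} id (indicator ∘ b) = go b u₀ hit unique
  where
  go : ∀ {m} (b : Fin m → Bool) (u₀ : Fin m) → b u₀ ≡ true → (∀ u → b u ≡ true → u ≡ u₀) →
       sum (tabulate (indicator ∘ b)) ≡ 1
  go {suc m} b Fin.zero hit unique rewrite hit = cong suc (count-none (b ∘ Fin.suc) rest)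
    where
    rest : ∀ u → b (Fin.suc u) ≡ false
    rest u with b (Fin.suc u) in bu
    ... | false = refl
    ... | true with () ← unique (Fin.suc u) bu
  go {suc m} b (Fin.suc u₀) hit unique with b Fin.zero in b0
  ... | true with () ← unique Fin.zero b0
  ... | false = go (b ∘ Fin.suc) u₀ hit (λ u bu → Finₚ.suc-injective (unique (Fin.suc u) bu))

nbrsWithColour-one : ∀ {n c} (G : Graph n) (C : Fin n → Fin c) {v i} (u₀ : Fin n) →
  adj G v u₀ ≡ true → C u₀ ≡ i → (∀ u → adj G v u ≡ true → C u ≡ i → u ≡ u₀) →
  nbrsWithColour G C v i ≡ 1
nbrsWithColour-one G C {v} {i} u₀ vu₀ Cu₀ only = count-unique marked u₀ marked-u₀ only-marked
  where
  marked : Fin _ → Bool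
  marked u = adj G v u ∧ ⌊ C u Fin.≟ i ⌋
  marked-u₀ : marked u₀ ≡ true
  marked-u₀ rewrite vu₀ | Cu₀ with i Fin.≟ i
  ... | yes _ = refl
  ... | no i≢i = ⊥-elim (i≢i refl)
  only-marked : ∀ u → marked u ≡ true → u ≡ u₀
  only-marked u mu with adj G v u in vu | C u Fin.≟ i
  ... | true | yes Cu≡i = only u vu Cu≡i

Colour : Set
Colour = Fin 3

fresh : Colour → Colour → Colour
fresh 0F 0F = 1F
fresh 0F 1F = 2F
fresh 0F 2F = 1F
fresh 1F 0F = 2F
fresh 1F 1F = 0F
fresh 1F 2F = 0F
fresh 2F 0F = 1F
fresh 2F 1F = 0F
fresh 2F 2F = 0F

fresh-avoids : ∀ a b → fresh a b ≢ a × fresh a b ≢ b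
fresh-avoids 0F 0F = (λ ()) , (λ ())
fresh-avoids 0F 1F = (λ ()) , (λ ())
fresh-avoids 0F 2F = (λ ()) , (λ ())
fresh-avoids 1F 0F = (λ ()) , (λ ())
fresh-avoids 1F 1F = (λ ()) , (λ ())
fresh-avoids 1F 2F = (λ ()) , (λ ())
fresh-avoids 2F 0F = (λ ()) , (λ ())
fresh-avoids 2F 1F = (λ ()) , (λ ())
fresh-avoids 2F 2F = (λ ()) , (λ ())

shorter : ∀ {x y a b f} → x ≤ a → a < b → b ≤ y → x < a ⊎ b < y → y ∸ x ≤ suc f → b ∸ a ≤ f
shorter {x} {y} {a} {b} x≤a a<b b≤y (inj₁ x<a) gap =
  s≤s⁻¹ (<-≤-trans (∸-monoʳ-< x<a (<⇒≤ a<b)) (≤-trans (∸-monoˡ-≤ x b≤y) gap))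
shorter {x} {y} {a} {b} x≤a a<b b≤y (inj₂ b<y) gap =
  s≤s⁻¹ (≤-<-trans (∸-monoʳ-≤ b x≤a) (<-≤-trans (∸-monoˡ-< b<y (≤-trans x≤a (<⇒≤ a<b))) gap))

split : {A : Set} → ℕ → (ℕ → A) → A → (ℕ → A) → ℕ → A
split q below at above v with <-cmp v q
... | tri< _ _ _ = below v
... | tri≈ _ _ _ = at
... | tri> _ _ _ = above v

module _ {A : Set} {q : ℕ} {below : ℕ → A} {at : A} {above : ℕ → A} where

  split-< : ∀ {v} → v < q → split q below at above v ≡ below v
  split-< {v} v<q with <-cmp v q
  ... | tri< _ _ _ = refl
  ... | tri≈ v≮q _ _ = ⊥-elim (v≮q v<q)
  ... | tri> v≮q _ _ = ⊥-elim (v≮q v<q)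

  split-≡ : split q below at above q ≡ at
  split-≡ with <-cmp q q
  ... | tri< _ q≢q _ = ⊥-elim (q≢q refl)
  ... | tri≈ _ _ _ = refl
  ... | tri> _ q≢q _ = ⊥-elim (q≢q refl)

  split-> : ∀ {v} → q < v → split q below at above v ≡ above v
  split-> {v} q<v with <-cmp v q
  ... | tri< _ _ v≯q = ⊥-elim (v≯q q<v)
  ... | tri≈ _ _ v≯q = ⊥-elim (v≯q q<v)
  ... | tri> _ _ _ = refl

data PathAvoiding (e : ℕ → ℕ → Bool) (c : ℕ) : ℕ → ℕ → Set where
  end : ∀ {u} → u ≢ c → PathAvoiding e c u u
  via : ∀ {u v w} → u ≢ c → e u v ≡ true → PathAvoiding e c v w → PathAvoiding e c u w

-- Two-connected outerplanar graphs whose vertices are numbered 0, …, n-1 in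
-- their order along the outer face: e is a symmetric irreflexive adjacency on
-- 0, …, n-1 with no crossing edges and no cut vertex.
module OnPositions
  (n : ℕ) (e : ℕ → ℕ → Bool)
  (e-sym : ∀ i j → e i j ≡ e j i)
  (e-irrefl : ∀ i → e i i ≡ false)
  (e-bounded : ∀ i j → e i j ≡ true → i < n)
  (noCrossing : ∀ a b c d → e a b ≡ true → e c d ≡ true → a < c → c < b → b < d → ⊥)
  (noCutVertex : ∀ c u w → c < n → u < n → w < n → u ≢ c → w ≢ c → PathAvoiding e c u w)
  where

  infix 4 _~_
  _~_ : ℕ → ℕ → Set
  u ~ v = e u v ≡ true

  ~-sym : ∀ {u v} → u ~ v → v ~ u
  ~-sym {u} {v} uv = trans (e-sym v u) uv

  ~-irrefl : ∀ {v} → ¬ v ~ v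
  ~-irrefl {v} vv with () ← trans (sym vv) (e-irrefl v)

  ~-boundedʳ : ∀ {u v} → u ~ v → v < n
  ~-boundedʳ uv = e-bounded _ _ (~-sym uv)

  ClosedExcept : (ℕ → Set) → ℕ → Set
  ClosedExcept S c = ∀ v w → S v → v ~ w → w ≡ c ⊎ S w

  closed-reach : ∀ {S c u w} → ClosedExcept S c → PathAvoiding e c u w → S u → S w
  closed-reach closed (end _) Su = Su
  closed-reach closed (via {u} {v} _ uv path) Su with closed u v Su uv | path
  ... | inj₁ refl | end v≢c = ⊥-elim (v≢c refl)
  ... | inj₁ refl | via v≢c _ _ = ⊥-elim (v≢c refl)
  ... | inj₂ Sv | _ = closed-reach closed path Sv

  noSeparation : ∀ {S c u w} → ClosedExcept S c → c < n → u < n → w < n → u ≢ c → w ≢ c → S u → S w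
  noSeparation closed c<n u<n w<n u≢c w≢c = closed-reach closed (noCutVertex _ _ _ c<n u<n w<n u≢c w≢c)

  below-edge : ∀ {a b v w} → a ~ b → a < v → v < b → v ~ w → a ≤ w × w ≤ b
  below-edge {a} {b} {v} {w} ab a<v v<b vw with a ≤? w | w ≤? b
  ... | yes a≤w | yes w≤b = a≤w , w≤b
  ... | no a≰w | _ = ⊥-elim (noCrossing w v a b (~-sym vw) ab (≰⇒> a≰w) a<v v<b)
  ... | _ | no w≰b = ⊥-elim (noCrossing a b v w ab vw a<v v<b (≰⇒> w≰b))

  farNbr : ℕ → ℕ → ℕ
  farNbr z zero = z
  farNbr z (suc b) with z <? suc b | e z (suc b)
  ... | yes _ | true = suc b
  ... | _ | _ = farNbr z b

  FarNbrSpec : ℕ → ℕ → ℕ → Set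
  FarNbrSpec z b m = m ≡ z ⊎ (z < m × m ≤ b × z ~ m)

  farNbrSpec-suc : ∀ {z b m} → FarNbrSpec z b m → FarNbrSpec z (suc b) m
  farNbrSpec-suc (inj₁ m≡z) = inj₁ m≡z
  farNbrSpec-suc (inj₂ (z<m , m≤b , zm)) = inj₂ (z<m , m≤n⇒m≤1+n m≤b , zm)

  farNbr-spec : ∀ z b → FarNbrSpec z b (farNbr z b)
  farNbr-spec z zero = inj₁ refl
  farNbr-spec z (suc b) with z <? suc b | e z (suc b) in zb
  ... | yes z<b | true = inj₂ (z<b , ≤-refl , zb)
  ... | yes _ | false = farNbrSpec-suc (farNbr-spec z b)
  ... | no _ | _ = farNbrSpec-suc (farNbr-spec z b)

  farNbr-max : ∀ {z b w} → farNbr z b < w → w ≤ b → z < w → ¬ z ~ w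
  farNbr-max {z} {zero} far<w w≤0 z<w _ = n≮0 (<-≤-trans z<w w≤0)
  farNbr-max {z} {suc b} {w} far<w w≤b z<w zw with z <? suc b | e z (suc b) in zb
  ... | yes _ | true = <-irrefl refl (<-≤-trans far<w w≤b)
  ... | no z≮b | _ = z≮b (<-≤-trans z<w w≤b)
  ... | yes _ | false with m≤n⇒m<n∨m≡n w≤b
  ...   | inj₁ w<b = farNbr-max far<w (s≤s⁻¹ w<b) z<w zw
  ...   | inj₂ refl with () ← trans (sym zb) zw

  InnerFace : (k : ℕ) → (Fin k → ℕ) → Set
  InnerFace k f = 3 ≤ k × (∀ i j → toℕ i < toℕ j → f i < f j) × (∀ i → f i < n) ×
                  (∀ i j → (f i ~ f j → CycNbr k i j) × (CycNbr k i j → f i ~ f j))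

  -- The inner face lying below an edge xy with x + 1 < y.  It is traced by the
  -- walk that starts at x and repeatedly moves to the farthest neighbour not
  -- beyond y (in the first step: strictly before y).
  module FaceBelow {x y : ℕ} (xy : x ~ y) (x+1<y : suc x < y) where

    x<y : x < y
    x<y = <-trans (n<1+n x) x+1<y

    y<n : y < n
    y<n = ~-boundedʳ xy

    bound : ℕ → ℕ
    bound zero = pred y
    bound (suc _) = y

    bound-≤ : ∀ i → bound i ≤ y
    bound-≤ zero = pred[n]≤n
    bound-≤ (suc _) = ≤-refl

    <y⇒≤bound : ∀ {v} i → v < y → v ≤ bound i
    <y⇒≤bound zero v<y = <⇒≤pred v<y
    <y⇒≤bound (suc _) v<y = <⇒≤ v<y

    walk : ℕ → ℕ
    walk zero = x
    walk (suc i) = farNbr (walk i) (bound i)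

    Shielded : ℕ → Set
    Shielded z = ∀ {v w} → z < v → v < y → v ~ w → z ≤ w × w ≤ y

    -- The first step makes progress: otherwise y would separate x from x + 1.
    first-progress : x < walk 1
    first-progress with farNbr-spec x (pred y)
    ... | inj₂ (x<m , _) = x<m
    ... | inj₁ m≡x = ⊥-elim (<-irrefl refl (proj₁ x-inside))
      where
      Inside : ℕ → Set
      Inside v = x < v × v < y
      closed : ClosedExcept Inside y
      closed v w (x<v , v<y) vw with below-edge xy x<v v<y vw
      ... | x≤w , w≤y with m≤n⇒m<n∨m≡n x≤w | m≤n⇒m<n∨m≡n w≤y
      ...   | inj₂ refl | _ = ⊥-elim (farNbr-max (subst (_< v) (sym m≡x) x<v) (<⇒≤pred v<y) x<v (~-sym vw))
      ...   | inj₁ _ | inj₂ w≡y = inj₁ w≡y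
      ...   | inj₁ x<w | inj₁ w<y = inj₂ (x<w , w<y)
      x-inside : Inside x
      x-inside = noSeparation closed y<n (<-trans x+1<y y<n) (<-trans x<y y<n)
                   (<⇒≢ x+1<y) (<⇒≢ x<y) (≤-refl , x+1<y)

    module Step (i : ℕ) (p<z : walk i < walk (suc i)) (p-shielded : Shielded (walk i)) where

      private
        p z : ℕ
        p = walk i
        z = walk (suc i)

      step-spec : p < z × z ≤ bound i × p ~ z
      step-spec with farNbr-spec p (bound i)
      ... | inj₁ z≡p = ⊥-elim (<-irrefl (sym z≡p) p<z)
      ... | inj₂ spec = spec

      step-edge : p ~ z
      step-edge = proj₂ (proj₂ step-spec)

      -- An edge from inside (z, y) to below z would cross pz, or, ending at p,
      -- contradict the choice of z as the farthest neighbour of p.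
      step-shielded : Shielded z
      step-shielded {v} {w} z<v v<y vw with p-shielded (<-trans p<z z<v) v<y vw
      ... | p≤w , w≤y with z ≤? w | m≤n⇒m<n∨m≡n p≤w
      ...   | yes z≤w | _ = z≤w , w≤y
      ...   | no _ | inj₂ refl = ⊥-elim (farNbr-max z<v (<y⇒≤bound i v<y) (<-trans p<z z<v) (~-sym vw))
      ...   | no z≰w | inj₁ p<w = ⊥-elim (noCrossing p z w v step-edge (~-sym vw) p<w (≰⇒> z≰w) z<v)

      -- Unless z = y, the walk moves on: otherwise p would separate z from y.
      step-progress : z < y → z < walk (suc (suc i))
      step-progress z<y with farNbr-spec z y
      ... | inj₂ (z<m , _) = z<m
      ... | inj₁ m≡z = ⊥-elim (<-irrefl refl (<-≤-trans z<y (proj₂ y-inside)))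
        where
        Inside : ℕ → Set
        Inside v = p < v × v ≤ z
        closed : ClosedExcept Inside p
        closed v w (p<v , v≤z) vw with p-shielded p<v (≤-<-trans v≤z z<y) vw
        ... | p≤w , w≤y with m≤n⇒m<n∨m≡n p≤w
        ...   | inj₂ p≡w = inj₁ (sym p≡w)
        ...   | inj₁ p<w with w ≤? z | m≤n⇒m<n∨m≡n v≤z
        ...     | yes w≤z | _ = inj₂ (p<w , w≤z)
        ...     | no w≰z | inj₂ refl =
          ⊥-elim (farNbr-max (subst (_< w) (sym m≡z) (≰⇒> w≰z)) w≤y (≰⇒> w≰z) vw)
        ...     | no w≰z | inj₁ v<z = ⊥-elim (noCrossing p z v w step-edge vw p<v v<z (≰⇒> w≰z))
        y-inside : Inside y
        y-inside = noSeparation closed (e-bounded _ _ step-edge) (~-boundedʳ step-edge) y<n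
                     (λ z≡p → <-irrefl (sym z≡p) p<z) (λ y≡p → <-irrefl (sym y≡p) (<-trans p<z z<y))
                     (p<z , ≤-refl)

    walk-stays : ∀ i → walk i ≡ y → walk (suc i) ≡ y
    walk-stays i wi≡y with farNbr-spec (walk i) (bound i)
    ... | inj₁ m≡wi = trans m≡wi wi≡y
    ... | inj₂ (wi<m , m≤b , _) =
      ⊥-elim (<-irrefl refl (<-≤-trans (subst (_< walk (suc i)) wi≡y wi<m) (≤-trans m≤b (bound-≤ i))))

    walk-invariant : ∀ i → walk i ≤ y × Shielded (walk i) × (walk i < y → walk i < walk (suc i))
    walk-invariant zero = <⇒≤ x<y , below-edge xy , λ _ → first-progress
    walk-invariant (suc i) with walk-invariant i
    ... | wi≤y , shielded , progress with m≤n⇒m<n∨m≡n wi≤y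
    ...   | inj₁ wi<y = ≤-trans (proj₁ (proj₂ step-spec)) (bound-≤ i) , step-shielded , step-progress
      where open Step i (progress wi<y) shielded
    ...   | inj₂ wi≡y = ≤-reflexive at-y , (λ y<v v<y _ → ⊥-elim (<-asym (subst (_< _) at-y y<v) v<y)) ,
                        (λ y<y → ⊥-elim (<-irrefl at-y y<y))
      where at-y = walk-stays i wi≡y

    walk-≤ : ∀ i → walk i ≤ y
    walk-≤ i = proj₁ (walk-invariant i)

    walk-shielded : ∀ i → Shielded (walk i)
    walk-shielded i = proj₁ (proj₂ (walk-invariant i))

    walk-progress : ∀ i → walk i < y → walk i < walk (suc i)
    walk-progress i = proj₂ (proj₂ (walk-invariant i))

    reaches : ∀ d i → y ∸ walk i ≤ d → (∀ j → j < i → walk j < y) →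
              ∃ λ K → walk K ≡ y × (∀ j → j < K → walk j < y)
    reaches d i gap before with m≤n⇒m<n∨m≡n (walk-≤ i)
    ... | inj₂ arrived = i , arrived , before
    reaches zero i gap before | inj₁ wi<y = ⊥-elim (<-irrefl refl (<-≤-trans (m<n⇒0<n∸m wi<y) gap))
    reaches (suc d) i gap before | inj₁ wi<y = reaches d (suc i) smaller before′
      where
      smaller : y ∸ walk (suc i) ≤ d
      smaller = s≤s⁻¹ (<-≤-trans (∸-monoʳ-< (walk-progress i wi<y) (walk-≤ (suc i))) gap)
      before′ : ∀ j → j < suc i → walk j < y
      before′ j j<1+i with m≤n⇒m<n∨m≡n (s≤s⁻¹ j<1+i)
      ... | inj₁ j<i = before j j<i
      ... | inj₂ refl = wi<y

    K : ℕ
    K = proj₁ (reaches (y ∸ x) 0 ≤-refl (λ _ ()))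

    walk-end : walk K ≡ y
    walk-end = proj₁ (proj₂ (reaches (y ∸ x) 0 ≤-refl (λ _ ())))

    walk-<y : ∀ j → j < K → walk j < y
    walk-<y = proj₂ (proj₂ (reaches (y ∸ x) 0 ≤-refl (λ _ ())))

    walk-step : ∀ j → j < K → walk j < walk (suc j)
    walk-step j j<K = walk-progress j (walk-<y j j<K)

    walk-increasing : ∀ {i j} → i < j → j ≤ K → walk i < walk j
    walk-increasing {i} {suc j} i<1+j 1+j≤K with m≤n⇒m<n∨m≡n (s≤s⁻¹ i<1+j)
    ... | inj₂ refl = walk-step i 1+j≤K
    ... | inj₁ i<j = <-trans (walk-increasing i<j (<⇒≤ 1+j≤K)) (walk-step j 1+j≤K)

    walk-edge : ∀ j → j < K → walk j ~ walk (suc j)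
    walk-edge j j<K = Step.step-edge j (walk-step j j<K) (walk-shielded j)

    -- Apart from the closing edge xy, no two non-consecutive walk vertices are
    -- adjacent: such an edge would lead farther than the step actually taken.
    walk-nonconsecutive : ∀ {a b} → suc a < b → b ≤ K → walk a ~ walk b → a ≡ 0 × b ≡ K
    walk-nonconsecutive {zero} {b} 1<b b≤K xb with b ≟ K
    ... | yes b≡K = refl , b≡K
    ... | no b≢K = ⊥-elim (farNbr-max (walk-increasing 1<b b≤K) (<⇒≤pred (walk-<y b (≤∧≢⇒< b≤K b≢K)))
                                      (walk-increasing (<-trans z<s 1<b) b≤K) xb)
    walk-nonconsecutive {suc a} {b} 2+a<b b≤K ab =
      ⊥-elim (farNbr-max (walk-increasing 2+a<b b≤K) (walk-≤ b)
                         (walk-increasing (<-trans (n<1+n _) 2+a<b) b≤K) ab)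

    CycNbrℕ : ℕ → ℕ → Set
    CycNbrℕ a b =
      (b ≡ suc a) ⊎ (a ≡ suc b) ⊎ ((a ≡ 0) × (suc b ≡ suc K)) ⊎ ((b ≡ 0) × (suc a ≡ suc K))

    walk-edge-forward : ∀ {a b} → a < b → b ≤ K → walk a ~ walk b → b ≡ suc a ⊎ (a ≡ 0 × b ≡ K)
    walk-edge-forward {a} {b} a<b b≤K ab with b ≟ suc a
    ... | yes b≡1+a = inj₁ b≡1+a
    ... | no b≢1+a = inj₂ (walk-nonconsecutive (≤∧≢⇒< a<b (b≢1+a ∘ sym)) b≤K ab)

    walk-edge⇒cyclic : ∀ {a b} → a ≤ K → b ≤ K → walk a ~ walk b → CycNbrℕ a b
    walk-edge⇒cyclic {a} {b} a≤K b≤K ab with <-cmp a b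
    ... | tri≈ _ refl _ = ⊥-elim (~-irrefl ab)
    ... | tri< a<b _ _ with walk-edge-forward a<b b≤K ab
    ...   | inj₁ b≡1+a = inj₁ b≡1+a
    ...   | inj₂ (a≡0 , b≡K) = inj₂ (inj₂ (inj₁ (a≡0 , cong suc b≡K)))
    walk-edge⇒cyclic {a} {b} a≤K b≤K ab | tri> _ _ b<a with walk-edge-forward b<a a≤K (~-sym ab)
    ... | inj₁ a≡1+b = inj₂ (inj₁ a≡1+b)
    ... | inj₂ (b≡0 , a≡K) = inj₂ (inj₂ (inj₂ (b≡0 , cong suc a≡K)))

    cyclic⇒walk-edge : ∀ {a b} → a ≤ K → b ≤ K → CycNbrℕ a b → walk a ~ walk b
    cyclic⇒walk-edge {a} a≤K b≤K (inj₁ refl) = walk-edge a b≤K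
    cyclic⇒walk-edge {b = b} a≤K b≤K (inj₂ (inj₁ refl)) = ~-sym (walk-edge b a≤K)
    cyclic⇒walk-edge a≤K b≤K (inj₂ (inj₂ (inj₁ (refl , 1+b≡1+K)))) = x~walk (suc-injective 1+b≡1+K)
      where x~walk : ∀ {b} → b ≡ K → x ~ walk b
            x~walk refl = subst (x ~_) (sym walk-end) xy
    cyclic⇒walk-edge a≤K b≤K (inj₂ (inj₂ (inj₂ (refl , 1+a≡1+K)))) =
      ~-sym (cyclic⇒walk-edge b≤K a≤K (inj₂ (inj₂ (inj₁ (refl , 1+a≡1+K)))))

    walk₁<y : walk 1 < y
    walk₁<y with farNbr-spec x (pred y)
    ... | inj₁ w₁≡x = subst (_< y) (sym w₁≡x) x<y
    ... | inj₂ (_ , w₁≤pred-y , _) = m≤pred[n]⇒suc[m]≤n {{>-nonZero (≤-<-trans z≤n x<y)}} w₁≤pred-y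

    2≤K : 2 ≤ K
    2≤K with K | walk-end
    ... | zero | x≡y = ⊥-elim (<-irrefl x≡y x<y)
    ... | suc zero | w₁≡y = ⊥-elim (<-irrefl w₁≡y walk₁<y)
    ... | suc (suc _) | _ = s≤s (s≤s z≤n)

    walk-face : InnerFace (suc K) (walk ∘ toℕ)
    walk-face = s≤s 2≤K , (λ i j i<j → walk-increasing i<j (index≤K j)) ,
                (λ i → ≤-<-trans (walk-≤ (toℕ i)) y<n) ,
                (λ i j → walk-edge⇒cyclic (index≤K i) (index≤K j) ,
                         cyclic⇒walk-edge (index≤K i) (index≤K j))
      where
      index≤K : (i : Fin (suc K)) → toℕ i ≤ K
      index≤K i = s≤s⁻¹ (toℕ<n i)

    walk-nbrs : ∀ i → suc (suc i) ≤ K → ∀ {u} → walk (suc i) ~ u → walk i ≤ u × u ≤ walk (suc (suc i))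
    walk-nbrs i 2+i≤K {u} wu with walk-shielded i (walk-step i (<-trans (n<1+n _) 2+i≤K)) (walk-<y (suc i) 2+i≤K) wu
    ... | wi≤u , u≤y with u ≤? walk (suc (suc i))
    ...   | yes u≤next = wi≤u , u≤next
    ...   | no u≰next =
      ⊥-elim (farNbr-max (≰⇒> u≰next) u≤y (<-trans (walk-step (suc i) 2+i≤K) (≰⇒> u≰next)) wu)

    x-nbrs : ∀ {v} → x < v → v < y → x ~ v → v ≤ walk 1
    x-nbrs {v} x<v v<y xv with v ≤? walk 1
    ... | yes v≤w₁ = v≤w₁
    ... | no v≰w₁ = ⊥-elim (farNbr-max (≰⇒> v≰w₁) (<⇒≤pred v<y) x<v xv)

    y-nbrs : ∀ i → i < K → ∀ {v} → x < v → v < walk i → ¬ y ~ v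
    y-nbrs zero _ x<v v<x _ = <-asym x<v v<x
    y-nbrs (suc i) 1+i<K {v} x<v v<next yv with <-cmp v (walk i)
    ... | tri< v<wi _ _ = y-nbrs i (<-trans (n<1+n i) 1+i<K) x<v v<wi yv
    ... | tri> _ _ wi<v =
      <-irrefl refl (<-≤-trans (walk-<y (suc i) 1+i<K) (proj₂ (below-edge (walk-edge i i<K) wi<v v<next (~-sym yv))))
      where i<K = <-trans (n<1+n i) 1+i<K
    y-nbrs (suc zero) _ x<v v<next yv | tri≈ _ refl _ = <-irrefl refl x<v
    y-nbrs (suc (suc i)) 2+i<K x<v v<next yv | tri≈ _ refl _ =
      farNbr-max (walk-<y _ 2+i<K) ≤-refl (walk-<y (suc i) (<-trans (n<1+n _) 2+i<K)) (~-sym yv)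

  -- The outer face: the first and the last vertex are adjacent, for otherwise
  -- the farthest neighbour of 0 would be a cut vertex (or 0 would be isolated).
  outer-edge : 3 ≤ n → 0 ~ pred n
  outer-edge 3≤n with farNbr-spec 0 (pred n)
  ... | inj₁ m≡0 =
    ⊥-elim (1+n≢0 (noSeparation {S = _≡ 0} isolated 3≤n (<-trans z<s 3≤n) (<-trans (n<1+n 1) 3≤n) (λ ()) (λ ()) refl))
    where
    isolated : ClosedExcept (_≡ 0) 2
    isolated .0 zero refl _ = inj₂ refl
    isolated .0 (suc w) refl 0w =
      ⊥-elim (farNbr-max (subst (_< suc w) (sym m≡0) z<s) (<⇒≤pred (~-boundedʳ 0w)) z<s 0w)
  ... | inj₂ (0<m , m≤last , 0m) with m≤n⇒m<n∨m≡n m≤last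
  ...   | inj₂ m≡last = subst (0 ~_) m≡last 0m
  ...   | inj₁ m<last = ⊥-elim (n≮0 (proj₁ 0-beyond))
    where
    m = farNbr 0 (pred n)
    n≢0 : NonZero n
    n≢0 = >-nonZero (<-trans z<s 3≤n)
    Beyond : ℕ → Set
    Beyond v = m < v × v ≤ pred n
    closed : ClosedExcept Beyond m
    closed v w (m<v , v≤last) vw with <-cmp w m
    ... | tri≈ _ w≡m _ = inj₁ w≡m
    ... | tri> _ _ m<w = inj₂ (m<w , <⇒≤pred (~-boundedʳ vw))
    closed v zero (m<v , v≤last) vw | tri< _ _ _ = ⊥-elim (farNbr-max m<v v≤last (<-trans 0<m m<v) (~-sym vw))
    closed v (suc w) (m<v , v≤last) vw | tri< w<m _ _ = ⊥-elim (noCrossing 0 m (suc w) v 0m (~-sym vw) z<s w<m m<v)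
    0-beyond : Beyond 0
    0-beyond = noSeparation closed (~-boundedʳ 0m) (m≤pred[n]⇒suc[m]≤n {{n≢0}} ≤-refl) (<-trans z<s 3≤n)
                 (λ last≡m → <-irrefl (sym last≡m) m<last) (λ 0≡m → <-irrefl 0≡m 0<m) (m<last , ≤-refl)

  record Pentagon (x y : ℕ) : Set where
    field
      q₁ q₂ q₃ : ℕ
      x<q₁ : x < q₁
      q₁<q₂ : q₁ < q₂
      q₂<q₃ : q₂ < q₃
      q₃<y : q₃ < y
      x~q₁ : x ~ q₁
      q₁~q₂ : q₁ ~ q₂
      q₂~q₃ : q₂ ~ q₃
      q₃~y : q₃ ~ y
      nbrs₁ : ∀ {u} → q₁ ~ u → x ≤ u × u ≤ q₂
      nbrs₂ : ∀ {u} → q₂ ~ u → q₁ ≤ u × u ≤ q₃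
      nbrs₃ : ∀ {u} → q₃ ~ u → q₂ ≤ u × u ≤ y
      nbrsˣ : ∀ {v} → x < v → v < y → x ~ v → v ≤ q₁
      nbrsʸ : ∀ {v} → x < v → v < q₃ → ¬ y ~ v

  pentagon-below : (∀ k f → InnerFace k f → k ≡ 5) → ∀ {x y} → x ~ y → suc x < y → Pentagon x y
  pentagon-below pentagonal {x} {y} xy x+1<y = record
    { q₁ = walk 1 ; q₂ = walk 2 ; q₃ = walk 3
    ; x<q₁ = walk-step 0 (≤K 1≤4) ; q₁<q₂ = walk-step 1 (≤K 2≤4) ; q₂<q₃ = walk-step 2 (≤K 3≤4)
    ; q₃<y = walk-<y 3 (≤K ≤-refl)
    ; x~q₁ = walk-edge 0 (≤K 1≤4) ; q₁~q₂ = walk-edge 1 (≤K 2≤4) ; q₂~q₃ = walk-edge 2 (≤K 3≤4)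
    ; q₃~y = subst (walk 3 ~_) walk₄≡y (walk-edge 3 (≤K ≤-refl))
    ; nbrs₁ = walk-nbrs 0 (≤K 2≤4) ; nbrs₂ = walk-nbrs 1 (≤K 3≤4)
    ; nbrs₃ = λ q₃u → map₂ (λ u≤w₄ → subst (_ ≤_) walk₄≡y u≤w₄) (walk-nbrs 2 (≤K ≤-refl) q₃u)
    ; nbrsˣ = x-nbrs ; nbrsʸ = y-nbrs 3 (≤K ≤-refl)
    }
    where
    open FaceBelow xy x+1<y
    K≡4 : K ≡ 4
    K≡4 = suc-injective (pentagonal _ _ walk-face)
    ≤K : ∀ {j} → j ≤ 4 → j ≤ K
    ≤K j≤4 = subst (_ ≤_) (sym K≡4) j≤4
    walk₄≡y : walk 4 ≡ y
    walk₄≡y = subst (λ k → walk k ≡ y) K≡4 walk-end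
    1≤4 : 1 ≤ 4
    1≤4 = s≤s z≤n
    2≤4 : 2 ≤ 4
    2≤4 = s≤s (s≤s z≤n)
    3≤4 : 3 ≤ 4
    3≤4 = s≤s (s≤s (s≤s z≤n))

  HasUniqueColour : (ℕ → Colour) → ℕ → Set
  HasUniqueColour C v = ∃ λ w → v ~ w × (∀ {u} → v ~ u → C u ≡ C w → u ≡ w)

  -- The invariant of the colouring below an edge xy: every vertex strictly
  -- between x and y has a uniquely coloured neighbour, and the interior
  -- neighbours of x (of y) avoid the colour fx (fy), which is reserved as the
  -- unique colour that x (y) sees on its other side.
  record GoodBelow (C : ℕ → Colour) (x y : ℕ) (fx fy : Colour) : Set where
    field
      unique : ∀ {v} → x < v → v < y → HasUniqueColour C v
      avoidˣ : ∀ {v} → x < v → v < y → x ~ v → C v ≢ fx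
      avoidʸ : ∀ {v} → x < v → v < y → y ~ v → C v ≢ fy

  goodBelow-empty : ∀ {C x y fx fy} → ¬ suc x < y → GoodBelow C x y fx fy
  goodBelow-empty x+1≮y = record
    { unique = λ x<v v<y → ⊥-elim (x+1≮y (≤-<-trans x<v v<y))
    ; avoidˣ = λ x<v v<y _ → ⊥-elim (x+1≮y (≤-<-trans x<v v<y))
    ; avoidʸ = λ x<v v<y _ → ⊥-elim (x+1≮y (≤-<-trans x<v v<y)) }

  unique-between : ∀ {C p q r fp fr c w} → (∀ {u} → q ~ u → p ≤ u × u ≤ r) →
    GoodBelow C p q fp c → GoodBelow C q r c fr → q ~ w → C w ≡ c →
    (w ≡ p × C r ≢ c) ⊎ (w ≡ r × C p ≢ c) → HasUniqueColour C q
  unique-between {C} {p} {q} {r} {c = c} {w} nbrs left right qw Cw≡c endpoint = w , qw , only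
    where
    at-p : (w ≡ p × C r ≢ c) ⊎ (w ≡ r × C p ≢ c) → C p ≡ c → p ≡ w
    at-p (inj₁ (w≡p , _)) _ = sym w≡p
    at-p (inj₂ (_ , Cp≢c)) Cp≡c = ⊥-elim (Cp≢c Cp≡c)
    at-r : (w ≡ p × C r ≢ c) ⊎ (w ≡ r × C p ≢ c) → C r ≡ c → r ≡ w
    at-r (inj₁ (_ , Cr≢c)) Cr≡c = ⊥-elim (Cr≢c Cr≡c)
    at-r (inj₂ (w≡r , _)) _ = sym w≡r
    only : ∀ {u} → q ~ u → C u ≡ C w → u ≡ w
    only {u} qu Cu≡Cw with nbrs qu | <-cmp u q
    ... | _ | tri≈ _ refl _ = ⊥-elim (~-irrefl qu)
    ... | p≤u , _ | tri< u<q _ _ with m≤n⇒m<n∨m≡n p≤u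
    ...   | inj₁ p<u = ⊥-elim (GoodBelow.avoidʸ left p<u u<q qu (trans Cu≡Cw Cw≡c))
    ...   | inj₂ refl = at-p endpoint (trans Cu≡Cw Cw≡c)
    only {u} qu Cu≡Cw | _ , u≤r | tri> _ _ q<u with m≤n⇒m<n∨m≡n u≤r
    ...   | inj₁ u<r = ⊥-elim (GoodBelow.avoidˣ right q<u u<r qu (trans Cu≡Cw Cw≡c))
    ...   | inj₂ refl = at-r endpoint (trans Cu≡Cw Cw≡c)

  module Colouring (pentagonal : ∀ k f → InnerFace k f → k ≡ 5) where

    -- The pentagon x q₁ q₂ q₃ y below xy gets colours with c₁ ≠ fx,
    -- c₂ ∉ {cx, cy} and c₃ ∉ {fy, c₁}; then q₁, q₂, q₃ see x, q₁, y with a unique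
    -- colour, and the four edges of the pentagon are treated recursively with
    -- those colours reserved.
    mutual
      fillBelow : ℕ → (x y : ℕ) → x ~ y → (cx cy fx fy : Colour) → ℕ → Colour
      fillBelow zero x y xy cx cy fx fy = λ _ → 0F
      fillBelow (suc fuel) x y xy cx cy fx fy with suc x <? y
      ... | no _ = λ _ → 0F
      ... | yes x+1<y = fillPentagon fuel (pentagon-below pentagonal xy x+1<y) cx cy fx fy

      fillPentagon : ℕ → ∀ {x y} → Pentagon x y → (cx cy fx fy : Colour) → ℕ → Colour
      fillPentagon fuel {x} {y} P cx cy fx fy =
        split q₁ (fillBelow fuel x q₁ x~q₁ cx c₁ fx cx) c₁
       (split q₂ (fillBelow fuel q₁ q₂ q₁~q₂ c₁ c₂ cx c₁) c₂
       (split q₃ (fillBelow fuel q₂ q₃ q₂~q₃ c₂ c₃ c₁ cy) c₃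
                 (fillBelow fuel q₃ y q₃~y c₃ cy cy fy)))
        where
        open Pentagon P
        c₁ c₂ c₃ : Colour
        c₁ = fresh fx fy
        c₂ = fresh cx cy
        c₃ = fresh fy c₁

    module PentagonStep {fuel x y} (P : Pentagon x y) {cx cy fx fy : Colour} (C : ℕ → Colour)
      (gap : y ∸ x ≤ suc fuel) (Cx : C x ≡ cx) (Cy : C y ≡ cy)
      (agrees : ∀ {v} → x < v → v < y → C v ≡ fillPentagon fuel P cx cy fx fy v)
      (recurse : ∀ {a b} (ab : a ~ b) {ca cb fa fb} → b ∸ a ≤ fuel → C a ≡ ca → C b ≡ cb →
                 (∀ {v} → a < v → v < b → C v ≡ fillBelow fuel a b ab ca cb fa fb v) → GoodBelow C a b fa fb)
      where

      open Pentagon P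

      c₁ c₂ c₃ : Colour
      c₁ = fresh fx fy
      c₂ = fresh cx cy
      c₃ = fresh fy c₁

      q₁<y : q₁ < y
      q₁<y = <-trans q₁<q₂ (<-trans q₂<q₃ q₃<y)
      q₂<y : q₂ < y
      q₂<y = <-trans q₂<q₃ q₃<y
      x<q₂ : x < q₂
      x<q₂ = <-trans x<q₁ q₁<q₂
      q₁<q₃ : q₁ < q₃
      q₁<q₃ = <-trans q₁<q₂ q₂<q₃
      x<q₃ : x < q₃
      x<q₃ = <-trans x<q₂ q₂<q₃

      colour₁ : C q₁ ≡ c₁
      colour₁ = trans (agrees x<q₁ q₁<y) (split-≡ {q = q₁})
      colour₂ : C q₂ ≡ c₂
      colour₂ = trans (agrees x<q₂ q₂<y) (trans (split-> q₁<q₂) (split-≡ {q = q₂}))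
      colour₃ : C q₃ ≡ c₃
      colour₃ = trans (agrees x<q₃ q₃<y)
                      (trans (split-> q₁<q₃) (trans (split-> q₂<q₃) (split-≡ {q = q₃})))

      avoids : ∀ {v c d} → C v ≡ c → c ≢ d → C v ≢ d
      avoids Cv≡c c≢d Cv≡d = c≢d (trans (sym Cv≡c) Cv≡d)

      q₁≢fx : C q₁ ≢ fx
      q₁≢fx = avoids colour₁ (proj₁ (fresh-avoids fx fy))
      q₂≢cx : C q₂ ≢ cx
      q₂≢cx = avoids colour₂ (proj₁ (fresh-avoids cx cy))
      q₂≢cy : C q₂ ≢ cy
      q₂≢cy = avoids colour₂ (proj₂ (fresh-avoids cx cy))
      q₃≢fy : C q₃ ≢ fy
      q₃≢fy = avoids colour₃ (proj₁ (fresh-avoids fy c₁))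
      q₃≢c₁ : C q₃ ≢ c₁
      q₃≢c₁ = avoids colour₃ (proj₂ (fresh-avoids fy c₁))

      below₁ : GoodBelow C x q₁ fx cx
      below₁ = recurse x~q₁ (shorter ≤-refl x<q₁ (<⇒≤ q₁<y) (inj₂ q₁<y) gap) Cx colour₁
        λ x<v v<q₁ → trans (agrees x<v (<-trans v<q₁ q₁<y)) (split-< v<q₁)
      below₂ : GoodBelow C q₁ q₂ cx c₁
      below₂ = recurse q₁~q₂ (shorter (<⇒≤ x<q₁) q₁<q₂ (<⇒≤ q₂<y) (inj₁ x<q₁) gap) colour₁ colour₂
        λ q₁<v v<q₂ → trans (agrees (<-trans x<q₁ q₁<v) (<-trans v<q₂ q₂<y))
                            (trans (split-> q₁<v) (split-< v<q₂))
      below₃ : GoodBelow C q₂ q₃ c₁ cy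
      below₃ = recurse q₂~q₃ (shorter (<⇒≤ x<q₂) q₂<q₃ (<⇒≤ q₃<y) (inj₁ x<q₂) gap) colour₂ colour₃
        λ q₂<v v<q₃ → trans (agrees (<-trans x<q₂ q₂<v) (<-trans v<q₃ q₃<y))
                            (trans (split-> (<-trans q₁<q₂ q₂<v)) (trans (split-> q₂<v) (split-< v<q₃)))
      below₄ : GoodBelow C q₃ y cy fy
      below₄ = recurse q₃~y (shorter (<⇒≤ x<q₃) q₃<y ≤-refl (inj₁ x<q₃) gap) colour₃ Cy
        λ q₃<v v<y → trans (agrees (<-trans x<q₃ q₃<v) v<y)
                           (trans (split-> (<-trans q₁<q₃ q₃<v))
                           (trans (split-> (<-trans q₂<q₃ q₃<v)) (split-> q₃<v)))

      -- q₁ sees cx only at x, q₂ sees c₁ only at q₁, q₃ sees cy only at y.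
      unique₁ : HasUniqueColour C q₁
      unique₁ = unique-between nbrs₁ below₁ below₂ (~-sym x~q₁) Cx (inj₁ (refl , q₂≢cx))
      unique₂ : HasUniqueColour C q₂
      unique₂ = unique-between nbrs₂ below₂ below₃ (~-sym q₁~q₂) colour₁ (inj₁ (refl , q₃≢c₁))
      unique₃ : HasUniqueColour C q₃
      unique₃ = unique-between nbrs₃ below₃ below₄ q₃~y Cy (inj₂ (refl , q₂≢cy))

      good : GoodBelow C x y fx fy
      good = record { unique = unique ; avoidˣ = avoidˣ ; avoidʸ = avoidʸ }
        where
        unique : ∀ {v} → x < v → v < y → HasUniqueColour C v
        unique {v} x<v v<y with <-cmp v q₁ | <-cmp v q₂ | <-cmp v q₃
        ... | tri< v<q₁ _ _ | _ | _ = GoodBelow.unique below₁ x<v v<q₁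
        ... | tri≈ _ refl _ | _ | _ = unique₁
        ... | tri> _ _ q₁<v | tri< v<q₂ _ _ | _ = GoodBelow.unique below₂ q₁<v v<q₂
        ... | tri> _ _ _ | tri≈ _ refl _ | _ = unique₂
        ... | tri> _ _ _ | tri> _ _ q₂<v | tri< v<q₃ _ _ = GoodBelow.unique below₃ q₂<v v<q₃
        ... | tri> _ _ _ | tri> _ _ _ | tri≈ _ refl _ = unique₃
        ... | tri> _ _ _ | tri> _ _ _ | tri> _ _ q₃<v = GoodBelow.unique below₄ q₃<v v<y
        avoidˣ : ∀ {v} → x < v → v < y → x ~ v → C v ≢ fx
        avoidˣ {v} x<v v<y xv with m≤n⇒m<n∨m≡n (nbrsˣ x<v v<y xv)
        ... | inj₁ v<q₁ = GoodBelow.avoidˣ below₁ x<v v<q₁ xv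
        ... | inj₂ refl = q₁≢fx
        avoidʸ : ∀ {v} → x < v → v < y → y ~ v → C v ≢ fy
        avoidʸ {v} x<v v<y yv with <-cmp v q₃
        ... | tri< v<q₃ _ _ = ⊥-elim (nbrsʸ x<v v<q₃ yv)
        ... | tri≈ _ refl _ = q₃≢fy
        ... | tri> _ _ q₃<v = GoodBelow.avoidʸ below₄ q₃<v v<y yv

    fillBelow-good : ∀ fuel (C : ℕ → Colour) {x y} (xy : x ~ y) {cx cy fx fy} → y ∸ x ≤ fuel →
      C x ≡ cx → C y ≡ cy → (∀ {v} → x < v → v < y → C v ≡ fillBelow fuel x y xy cx cy fx fy v) →
      GoodBelow C x y fx fy
    fillBelow-good zero C xy gap _ _ _ =
      goodBelow-empty (λ x+1<y → <-irrefl refl (<-≤-trans (m<n⇒0<n∸m (<-trans (n<1+n _) x+1<y)) gap))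
    fillBelow-good (suc fuel) C {x} {y} xy gap Cx Cy agrees with suc x <? y
    ... | no x+1≮y = goodBelow-empty x+1≮y
    ... | yes x+1<y = PentagonStep.good (pentagon-below pentagonal xy x+1<y) C gap Cx Cy agrees (fillBelow-good fuel C)

    -- The whole graph: colour 0 and n - 1 with 0F and 1F, each reserving the
    -- other's colour, and fill in below the outer edge.
    module _ (3≤n : 3 ≤ n) where

      outer-fill : ℕ → Colour
      outer-fill = fillBelow n 0 (pred n) (outer-edge 3≤n) 0F 1F 1F 0F

      colouring : ℕ → Colour
      colouring = split 0 (λ _ → 0F) 0F (split (pred n) outer-fill 1F (λ _ → 0F))

      0<last : 0 < pred n
      0<last = <-≤-trans z<s (pred-mono-≤ 3≤n)

      last<n : pred n < n
      last<n = m≤pred[n]⇒suc[m]≤n {{>-nonZero (<-trans z<s 3≤n)}} ≤-refl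

      colour-first : colouring 0 ≡ 0F
      colour-first = refl

      colour-last : colouring (pred n) ≡ 1F
      colour-last = trans (split-> 0<last) (split-≡ {q = pred n})

      outer-good : GoodBelow colouring 0 (pred n) 1F 0F
      outer-good = fillBelow-good n colouring (outer-edge 3≤n) (<⇒≤ (≤-<-trans (m∸n≤m (pred n) 0) last<n))
        colour-first colour-last (λ 0<v v<last → trans (split-> 0<v) (split-< v<last))

      -- Every vertex has a uniquely coloured neighbour: 0 sees 1F once (at n - 1),
      -- n - 1 sees 0F once (at 0), and the others are handled by outer-good.
      colouring-unique : ∀ {v} → v < n → HasUniqueColour colouring v
      colouring-unique {v} v<n with <-cmp v 0 | m≤n⇒m<n∨m≡n (<⇒≤pred v<n)
      ... | tri≈ _ refl _ | _ =
        unique-between (λ 0u → z≤n , <⇒≤pred (~-boundedʳ 0u)) (goodBelow-empty {fx = 0F} (λ ())) outer-good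
          (outer-edge 3≤n) colour-last (inj₂ (refl , λ ()))
      ... | tri> _ _ 0<v | inj₁ v<last = GoodBelow.unique outer-good 0<v v<last
      ... | tri> _ _ _ | inj₂ refl =
        unique-between (λ lu → z≤n , <⇒≤pred (~-boundedʳ lu))
          outer-good (goodBelow-empty {fy = 0F} (λ lt → <-asym lt (n<1+n _)))
          (~-sym (outer-edge 3≤n)) colour-first
          (inj₁ (refl , λ last≡0F → case trans (sym colour-last) last≡0F of λ ()))

module ByPosition {n : ℕ} (G : Graph n) (TC : TwoConnected G) (D : OuterplanarDrawing G) where

  position : Fin n → ℕ
  position v = toℕ (pos D v)

  vertexAt : ∀ {i} → i < n → Fin n
  vertexAt i<n = proj₁ (injective⇒surjective (pos D) (pos-inj D) (fromℕ< i<n))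

  position-vertexAt : ∀ {i} (i<n : i < n) → position (vertexAt i<n) ≡ i
  position-vertexAt i<n =
    trans (cong toℕ (proj₂ (injective⇒surjective (pos D) (pos-inj D) (fromℕ< i<n)))) (toℕ-fromℕ< i<n)

  vertexAt-position : ∀ v → vertexAt (toℕ<n (pos D v)) ≡ v
  vertexAt-position v = pos-inj D (toℕ-injective (position-vertexAt (toℕ<n (pos D v))))

  vertexAt-cong : ∀ {i j} (i<n : i < n) (j<n : j < n) → i ≡ j → vertexAt i<n ≡ vertexAt j<n
  vertexAt-cong _ _ refl = refl

  position-injective : ∀ {u v} → position u ≡ position v → u ≡ v
  position-injective eq = pos-inj D (toℕ-injective eq)

  edgeAt : ℕ → ℕ → Bool
  edgeAt i j with i <? n | j <? n
  ... | yes i<n | yes j<n = adj G (vertexAt i<n) (vertexAt j<n)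
  ... | _ | _ = false

  edgeAt-vertexAt : ∀ {i j} (i<n : i < n) (j<n : j < n) → edgeAt i j ≡ adj G (vertexAt i<n) (vertexAt j<n)
  edgeAt-vertexAt {i} {j} i<n j<n with i <? n | j <? n
  ... | yes _ | yes _ = refl
  ... | no i≮n | _ = ⊥-elim (i≮n i<n)
  ... | yes _ | no j≮n = ⊥-elim (j≮n j<n)

  edgeAt-position : ∀ u v → edgeAt (position u) (position v) ≡ adj G u v
  edgeAt-position u v =
    trans (edgeAt-vertexAt (toℕ<n _) (toℕ<n _)) (cong₂ (adj G) (vertexAt-position u) (vertexAt-position v))

  edgeAt-sym : ∀ i j → edgeAt i j ≡ edgeAt j i
  edgeAt-sym i j with i <? n | j <? n
  ... | yes _ | yes _ = Graph.sym G _ _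
  ... | yes _ | no _ = refl
  ... | no _ | yes _ = refl
  ... | no _ | no _ = refl

  edgeAt-irrefl : ∀ i → edgeAt i i ≡ false
  edgeAt-irrefl i with i <? n
  ... | yes _ = irrefl G _
  ... | no _ = refl

  edgeAt-bounded : ∀ i j → edgeAt i j ≡ true → i < n
  edgeAt-bounded i j ij with i <? n
  ... | yes i<n = i<n
  ... | no _ with () ← ij

  edgeAt-boundedʳ : ∀ i j → edgeAt i j ≡ true → j < n
  edgeAt-boundedʳ i j ij = edgeAt-bounded j i (trans (edgeAt-sym j i) ij)

  edgeAt-adj : ∀ {i j} (ij : edgeAt i j ≡ true) →
               adj G (vertexAt (edgeAt-bounded i j ij)) (vertexAt (edgeAt-boundedʳ i j ij)) ≡ true
  edgeAt-adj {i} {j} ij = trans (sym (edgeAt-vertexAt (edgeAt-bounded i j ij) (edgeAt-boundedʳ i j ij))) ij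

  edgeAt-noCrossing : ∀ a b c d → edgeAt a b ≡ true → edgeAt c d ≡ true → a < c → c < b → b < d → ⊥
  edgeAt-noCrossing a b c d ab cd a<c c<b b<d =
    noCross D (vertexAt a<n) (vertexAt b<n) (vertexAt c<n) (vertexAt d<n) (edgeAt-adj ab) (edgeAt-adj cd)
      (at a<n c<n a<c , at c<n b<n c<b , at b<n d<n b<d)
    where
    a<n = edgeAt-bounded a b ab
    b<n = edgeAt-boundedʳ a b ab
    c<n = edgeAt-bounded c d cd
    d<n = edgeAt-boundedʳ c d cd
    at : ∀ {i j} (i<n : i < n) (j<n : j < n) → i < j → position (vertexAt i<n) < position (vertexAt j<n)
    at i<n j<n = subst₂ _<_ (sym (position-vertexAt i<n)) (sym (position-vertexAt j<n))

  path-positions : ∀ {x u w} → Reach G (λ z → z ≢ x) u w →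
                   PathAvoiding edgeAt (position x) (position u) (position w)
  path-positions (here u≢x) = end (u≢x ∘ position-injective)
  path-positions (step u≢x uv path) =
    via (u≢x ∘ position-injective) (trans (edgeAt-position _ _) uv) (path-positions path)

  edgeAt-noCutVertex : ∀ c u w → c < n → u < n → w < n → u ≢ c → w ≢ c → PathAvoiding edgeAt c u w
  edgeAt-noCutVertex c u w c<n u<n w<n u≢c w≢c =
    subst₂ (λ c′ w′ → PathAvoiding edgeAt c′ u w′) (position-vertexAt c<n) (position-vertexAt w<n)
      (subst (λ u′ → PathAvoiding edgeAt _ u′ _) (position-vertexAt u<n)
        (path-positions (proj₂ (proj₂ TC) (vertexAt c<n) (vertexAt u<n) (vertexAt w<n)
                                          (distinct u<n u≢c) (distinct w<n w≢c))))
    where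
    distinct : ∀ {i} (i<n : i < n) → i ≢ c → vertexAt i<n ≢ vertexAt c<n
    distinct i<n i≢c eq = i≢c (trans (sym (position-vertexAt i<n)) (trans (cong position eq) (position-vertexAt c<n)))

  open OnPositions n edgeAt edgeAt-sym edgeAt-irrefl edgeAt-bounded edgeAt-noCrossing edgeAt-noCutVertex

  faces-pentagonal : (∀ k f → IsInnerFace D k f → k ≡ 5) → ∀ k h → InnerFace k h → k ≡ 5
  faces-pentagonal pentagonal k h (3≤k , increasing , bounded , cyclic) =
    pentagonal k (λ i → vertexAt (bounded i))
      (3≤k ,
       (λ i j i<j → subst₂ _<_ (sym (position-vertexAt (bounded i))) (sym (position-vertexAt (bounded j)))
                              (increasing i j i<j)) ,
       (λ i j → (λ ij → proj₁ (cyclic i j) (trans (edgeAt-vertexAt (bounded i) (bounded j)) ij)) ,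
                (λ cyc → trans (sym (edgeAt-vertexAt (bounded i) (bounded j))) (proj₂ (cyclic i j) cyc))))

  module _ (pentagonal : ∀ k f → IsInnerFace D k f → k ≡ 5) where

    open Colouring (faces-pentagonal pentagonal)

    colourOf : Fin n → Colour
    colourOf = colouring (proj₁ TC) ∘ position

    colourOf-complete : IsCompleteCFColouring G colourOf
    colourOf-complete v with colouring-unique (proj₁ TC) (toℕ<n (pos D v))
    ... | w , vw , only = colouring (proj₁ TC) w , nbrsWithColour-one G colourOf (vertexAt w<n) v~w
            (cong (colouring (proj₁ TC)) (position-vertexAt w<n)) only′
      where
      w<n : w < n
      w<n = edgeAt-boundedʳ _ _ vw
      v~w : adj G v (vertexAt w<n) ≡ true
      v~w = trans (sym (trans (edgeAt-vertexAt (toℕ<n (pos D v)) w<n)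
                              (cong (λ v′ → adj G v′ (vertexAt w<n)) (vertexAt-position v)))) vw
      only′ : ∀ u → adj G v u ≡ true → colourOf u ≡ colouring (proj₁ TC) w → u ≡ vertexAt w<n
      only′ u vu same = trans (sym (vertexAt-position u))
                              (vertexAt-cong (toℕ<n (pos D u)) w<n (only (trans (edgeAt-position v u) vu) same))

lemma1 : ∀ (n : ℕ) (G : Graph n) → TwoConnected G → (D : OuterplanarDrawing G) →
    (∀ (k : ℕ) (f : Fin k → Fin n) → IsInnerFace D k f → k ≡ 5) →
    ∃ λ (C : Fin n → Fin 3) → IsCompleteCFColouring G C
lemma1 n G TC D pentagonal = colourOf pentagonal , colourOf-complete pentagonal
  where open ByPosition G TC D
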